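{- Let $S$ be a transformation semigroup on a finite set which is a left-zero semigroup, generated by $a_1,\dots,a_r$. Then $\mathrm{Gr}(S)=\mathrm{Gr}(\{a_1,\dots,a_r\})$.
   Context: A semigroup is left-zero if $ab=a$ for all $a,b$ in it. Transformations act on the right. For a set $M$ of transformations of a finite set $V$, $\mathrm{Gr}(M)$ is the graph on $V$ in which distinct $v,w$ are adjacent iff there is no $f\in M$ with $vf=wf$. -}

module Defs where

open import Level using (Level; 0ℓ)
open import Data.Nat using (ℕ)
open import Data.Fin using (Fin)
open import Data.Product using (Σ; _×_)
open import Relation.Binary.PropositionalEquality using (_≡_; _≢_)
open import Relation.Nullary using (¬_)
open import Relation.Unary using (Pred)

Transformation : ℕ → Set
Transformation n = Fin n → Fin n

-- Right action: x (f · g) = (x f) g, i.e. apply f first, then g.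
_·_ : ∀ {n} → Transformation n → Transformation n → Transformation n
(f · g) x = g (f x)

TSet : ℕ → Set₁
TSet n = Pred (Transformation n) 0ℓ

data Generated {n r : ℕ} (a : Fin r → Transformation n) : Transformation n → Set where
  gen  : (i : Fin r) → Generated a (a i)
  comp : ∀ {f g} → Generated a f → Generated a g → Generated a (f · g)

GenSet : ∀ {n r} → (Fin r → Transformation n) → TSet n
GenSet a f = Σ (Fin _) (λ i → a i ≡ f)

IsLeftZero : ∀ {n} → TSet n → Set
IsLeftZero {n} M = ∀ {f g} → M f → M g → ∀ (x : Fin n) → (f · g) x ≡ f x

GrAdj : ∀ {n} → TSet n → Fin n → Fin n → Set
GrAdj M v w = v ≢ w × ¬ (Σ (Transformation _) (λ f → M f × f v ≡ f w))

module Submission where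

-- Adjacency in Gr(M) only depends on which pointwise behaviours occur in M:
-- if every element of M agrees pointwise with some element of N, then an edge
-- of Gr(N) is an edge of Gr(M) (`grAdj-covered`).
--
-- For S left-zero, every product f₁·…·f_k in S equals its first factor, so
-- by induction on the generation every element of S agrees pointwise with a
-- generator (`leftZero-head`).  Hence {a₁,…,a_r} ⊆ S and S is covered by
-- {a₁,…,a_r}; the two directions of the theorem follow.

open import Defs
open import Data.Nat using (ℕ)
open import Data.Fin using (Fin)
open import Function.Bundles using (_⇔_; mk⇔)
open import Data.Product using (Σ; _×_; _,_)
open import Relation.Binary.PropositionalEquality using (_≡_; refl; sym; trans)

CoveredBy : ∀ {n} → TSet n → TSet n → Set
CoveredBy {n} M N = ∀ {f} → M f → Σ (Transformation n) (λ g → N g × (∀ x → f x ≡ g x))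

grAdj-covered : ∀ {n} {M N : TSet n} → CoveredBy M N →
                ∀ {v w} → GrAdj N v w → GrAdj M v w
grAdj-covered cover {v} {w} (v≢w , noN) = v≢w , λ { (f , Mf , fv≡fw) →
  let (g , Ng , f≗g) = cover Mf in
  noN (g , Ng , trans (sym (f≗g v)) (trans fv≡fw (f≗g w))) }

grAdj-antitone : ∀ {n} {M N : TSet n} → (∀ {f} → M f → N f) →
                 ∀ {v w} → GrAdj N v w → GrAdj M v w
grAdj-antitone M⊆N = grAdj-covered (λ {f} Mf → f , M⊆N Mf , λ _ → refl)

leftZero-head : ∀ {n r} (a : Fin r → Transformation n) → IsLeftZero (Generated a) →
                ∀ {f} → Generated a f → Σ (Fin r) (λ i → ∀ x → f x ≡ a i x)
leftZero-head a lz (gen i)    = i , λ _ → refl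
leftZero-head a lz (comp p q) =
  let (i , f≗aᵢ) = leftZero-head a lz p in
  i , λ x → trans (lz p q x) (f≗aᵢ x)

generators⊆generated : ∀ {n r} (a : Fin r → Transformation n) →
                       ∀ {f} → GenSet a f → Generated a f
generators⊆generated a (i , refl) = gen i

mainTheorem18 : (n r : ℕ) (a : Fin r → Transformation n) →
    IsLeftZero (Generated a) →
    ∀ (v w : Fin n) → GrAdj (Generated a) v w ⇔ GrAdj (GenSet a) v w
mainTheorem18 n r a lz v w =
  mk⇔ (grAdj-antitone (generators⊆generated a)) (grAdj-covered covered)
  where
  covered : CoveredBy (Generated a) (GenSet a)
  covered p = let (i , f≗aᵢ) = leftZero-head a lz p in a i , (i , refl) , f≗aᵢ
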